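{- Let $H$ be a finite connected subgraph of $T_\infty$ and $y\in V(H)$ such that $E(H)\cap E(T_y)\ne\emptyset$ and $H$ contains no path from $y$ to a leaf of $T_y$. Then $\partial(H)\ge\frac12\big(|E(H)\cap E(T_y)|+1\big)$.
   Context: $T_\infty$ is the infinite tree whose vertex set is partitioned into levels $V_0,V_1,\dots$ such that each vertex of $V_j$ has exactly one neighbor in $V_{j+1}$ (its parent), each vertex of $V_j$ with $j\ge1$ has exactly two neighbors in $V_{j-1}$ (its children), there are no other edges, and any two vertices have a common ancestor; $V_0$ is the set of leaves. For $y\in V_j$, $T_y$ is the complete binary tree of height $j$ consisting of $y$ and all its descendants; its leaves are the vertices of $V_0$ below $y$. Subgraphs have no isolated vertices. $\partial(F)$ is the number of vertices of $F$ incident to at least one edge of $T_\infty$ not in $E(F)$. -}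

module Defs where

open import Data.Nat using (ℕ; zero; suc; _+_; _*_; _∸_; _<_; _/_)
open import Data.Nat.Properties using (_<?_)
import Data.Nat.Properties as ℕP
open import Data.Product using (Σ; ∃; _×_; _,_; proj₁; proj₂)
open import Data.Product.Properties using (≡-dec)
open import Data.Sum using (_⊎_)
open import Data.List using (List; []; _∷_; _++_; map; length; filter; deduplicate)
open import Data.List.Membership.Propositional using (_∈_; _∉_)
open import Data.List.Membership.DecPropositional using () renaming (_∈?_ to ∈?-gen)
open import Data.List.Relation.Unary.Unique.Propositional using (Unique)
open import Relation.Binary.PropositionalEquality using (_≡_)
open import Relation.Binary.Definitions using (DecidableEquality)
open import Relation.Nullary using (Dec; ¬_; ¬?)
open import Relation.Nullary.Decidable using (_×-dec_; _⊎-dec_)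
open import Data.Empty using (⊥)
open import Relation.Unary using (Decidable)

-- Model of T_∞ : vertex (j , n) is the n-th vertex of level V_j (n ∈ ℕ).
-- Parent of (j , n) is (j+1 , ⌊n/2⌋); children of (j+1 , n) are (j , 2n), (j , 2n+1).
Vertex : Set
Vertex = ℕ × ℕ

level : Vertex → ℕ
level = proj₁

parent : Vertex → Vertex
parent (j , n) = (suc j , n / 2)

anc : ℕ → Vertex → Vertex
anc zero v = v
anc (suc k) v = anc k (parent v)

_≟V_ : DecidableEquality Vertex
_≟V_ = ≡-dec ℕP._≟_ ℕP._≟_

_∈V?_ : (v : Vertex) (xs : List Vertex) → Dec (v ∈ xs)
_∈V?_ = ∈?-gen _≟V_

-- Every edge of T_∞ is {v , parent v}; it is represented by its lower endpoint v.
-- A finite subgraph (without isolated vertices) is a finite set of edges,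
-- given as a duplicate-free list of lower endpoints.
record Subgraph : Set where
  constructor mkSubgraph
  field
    edges  : List Vertex
    unique : Unique edges
open Subgraph public

Adj : Subgraph → Vertex → Vertex → Set
Adj H u v = (u ∈ edges H × v ≡ parent u) ⊎ (v ∈ edges H × u ≡ parent v)

InV : Subgraph → Vertex → Set
InV H v = ∃ λ u → Adj H v u

data Walk (H : Subgraph) : Vertex → Vertex → Set where
  here : ∀ {u} → Walk H u u
  step : ∀ {u v w} → Adj H u v → Walk H v w → Walk H u w

Connected : Subgraph → Set
Connected H = ∀ u v → InV H u → InV H v → Walk H u v

ProperDesc : Vertex → Vertex → Set
ProperDesc e y = level e < level y × anc (level y ∸ level e) e ≡ y

properDesc? : (y : Vertex) → Decidable (λ e → ProperDesc e y)
properDesc? y e = (level e <? level y) ×-dec (anc (level y ∸ level e) e ≟V y)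

-- the edge represented by e lies in E(T_y)  iff  e is a proper descendant of y
InETy : Vertex → Vertex → Set
InETy y e = ProperDesc e y

edgesInTy : Subgraph → Vertex → ℕ
edgesInTy H y = length (filter (properDesc? y) (edges H))

LeafOf : Vertex → Vertex → Set
LeafOf y ℓ = level ℓ ≡ 0 × anc (level y) ℓ ≡ y

-- v is incident to an edge of T_∞ not in E(H)
MissingIncident : Subgraph → Vertex → Set
MissingIncident H (zero , n) = (zero , n) ∉ edges H
MissingIncident H (suc j , n) =
  (suc j , n) ∉ edges H ⊎ ((j , 2 * n) ∉ edges H ⊎ (j , suc (2 * n)) ∉ edges H)

missingIncident? : (H : Subgraph) → Decidable (MissingIncident H)
missingIncident? H (zero , n) = ¬? ((zero , n) ∈V? edges H)
missingIncident? H (suc j , n) =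
  ¬? ((suc j , n) ∈V? edges H) ⊎-dec (¬? ((j , 2 * n) ∈V? edges H) ⊎-dec ¬? ((j , suc (2 * n)) ∈V? edges H))

vertexList : Subgraph → List Vertex
vertexList H = deduplicate _≟V_ (edges H ++ map parent (edges H))

boundary : Subgraph → ℕ
boundary H = length (filter (missingIncident? H) (vertexList H))

-- Consider the part of H hanging below y: the vertices reachable from y by walks of H inside T_y.
-- Every edge of H in T_y lies in it, since H is connected and the walk from such an edge up to y
-- cannot leave T_y without using an edge of T_y above it. Since no walk reaches a leaf, this part
-- is a finite binary tree whose branches all stop above level 0, and induction over T_y shows
-- that it has at least (e + 2) / 2 vertices missing an incident edge, where e is its number of
-- edges: a vertex with two children in H adds up the bounds of its two branches, and a vertex
-- with a missing child edge is itself such a boundary vertex.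
module Submission where

open import Defs
open import Data.Nat using (ℕ; zero; suc; _≤_; _<_; _*_; _+_; _∸_; _/_; _%_; z≤n; s≤s)
open import Data.Nat.Properties
open import Data.Nat.DivMod using (m*n/n≡m; +-distrib-/; m*n%n≡0; m≡m%n+[m/n]*n; m%n<n)
open import Data.Nat.Tactic.RingSolver using (solve)
open import Data.Product using (∃; _×_; _,_; proj₁; proj₂; uncurry)
open import Data.Sum using (_⊎_; inj₁; inj₂)
import Data.Sum as Sum
open import Data.Empty using (⊥-elim)
open import Data.List using (List; []; _∷_; _++_; length; filter)
open import Data.List.Properties using (length-++; filter-notAll)
open import Data.List.Membership.Propositional using (_∈_; _∉_)
open import Data.List.Membership.Propositional.Properties
  using (∈-filter⁺; ∈-filter⁻; ∈-++⁺ˡ; ∈-++⁺ʳ; ∈-++⁻; ∈-map⁺; ∈-deduplicate⁺)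
open import Data.List.Relation.Binary.Subset.Propositional using (_⊆_)
open import Data.List.Relation.Unary.Any using (here; there)
import Data.List.Relation.Unary.Any as Any
open import Data.List.Relation.Unary.All using ([])
import Data.List.Relation.Unary.All as All
open import Data.List.Relation.Unary.AllPairs using ([]; _∷_)
open import Data.List.Relation.Unary.Unique.Propositional using (Unique)
import Data.List.Relation.Unary.Unique.Propositional.Properties as Unique
open import Function using (_∘_)
open import Level using (Level)
open import Relation.Binary.Definitions using (DecidableEquality)
open import Relation.Binary.PropositionalEquality
open import Relation.Nullary using (¬_; Dec; yes; no; ¬?)

private
  variable
    a p : Level
    A : Set a
    P : Set p

unique-⊆⇒length-≤ : DecidableEquality A → {xs ys : List A} → Unique xs → xs ⊆ ys → length xs ≤ length ys
unique-⊆⇒length-≤ _≟_ {[]}     _ _ = z≤n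
unique-⊆⇒length-≤ _≟_ {x ∷ xs} {ys} (x∉xs ∷ unique) xs⊆ys = begin
  suc (length xs)                            ≤⟨ s≤s (unique-⊆⇒length-≤ _≟_ unique xs⊆ys-x) ⟩
  suc (length (filter (¬? ∘ (_≟ x)) ys))  ≤⟨ filter-notAll (¬? ∘ (_≟ x)) ys (Any.map (λ x≡z z≢x → z≢x (sym x≡z)) (xs⊆ys (here refl))) ⟩
  length ys                                  ∎
  where
  open ≤-Reasoning
  xs⊆ys-x : xs ⊆ filter (¬? ∘ (_≟ x)) ys
  xs⊆ys-x z∈xs = ∈-filter⁺ (¬? ∘ (_≟ x)) (xs⊆ys (there z∈xs)) (All.lookup x∉xs z∈xs ∘ sym)

keepIf : Dec P → List A → List A
keepIf (yes _) xs = xs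
keepIf (no _)  _  = []

keepIf-yes : (d : Dec P) {xs : List A} → P → keepIf d xs ≡ xs
keepIf-yes (yes _) _ = refl
keepIf-yes (no ¬p) p = ⊥-elim (¬p p)

∈-keepIf⁺ : (d : Dec P) {x : A} {xs : List A} → P → x ∈ xs → x ∈ keepIf d xs
∈-keepIf⁺ d p x∈xs = subst (_ ∈_) (sym (keepIf-yes d p)) x∈xs

∈-keepIf⁻ : (d : Dec P) {x : A} {xs : List A} → x ∈ keepIf d xs → P × x ∈ xs
∈-keepIf⁻ (yes p) x∈xs = p , x∈xs

keepIf-unique : (d : Dec P) {xs : List A} → Unique xs → Unique (keepIf d xs)
keepIf-unique (yes _) unique = unique
keepIf-unique (no _)  _      = []

branch-bounds-sum : ∀ {a b c d m} → 1 + a ≤ 2 * b + m → 1 + c ≤ 2 * d + m → 2 + (a + c) ≤ 2 * (m + (b + d))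
branch-bounds-sum {a} {b} {c} {d} {m} left right = begin
  2 + (a + c)             ≡⟨ solve (a ∷ c ∷ []) ⟩
  (1 + a) + (1 + c)       ≤⟨ +-mono-≤ left right ⟩
  (2 * b + m) + (2 * d + m) ≡⟨ solve (b ∷ d ∷ m ∷ []) ⟩
  2 * (m + (b + d))       ∎
  where open ≤-Reasoning

data Parity : ℕ → Set where
  even : ∀ q → Parity (2 * q)
  odd  : ∀ q → Parity (suc (2 * q))

parity : ∀ m → Parity m
parity m with m % 2 | m%n<n m 2 | m≡m%n+[m/n]*n m 2
... | zero        | _               | m≡ = subst Parity (sym (trans m≡ (*-comm (m / 2) 2))) (even (m / 2))
... | suc zero    | _               | m≡ = subst Parity (sym (trans m≡ (cong suc (*-comm (m / 2) 2)))) (odd (m / 2))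
... | suc (suc _) | s≤s (s≤s ())    | _

2*n/2≡n : ∀ n → 2 * n / 2 ≡ n
2*n/2≡n n = trans (cong (_/ 2) (*-comm 2 n)) (m*n/n≡m n 2)

[1+2*n]/2≡n : ∀ n → suc (2 * n) / 2 ≡ n
[1+2*n]/2≡n n = trans (+-distrib-/ 1 (2 * n) remainders<2) (2*n/2≡n n)
  where
  remainders<2 : 1 % 2 + 2 * n % 2 < 2
  remainders<2 rewrite trans (cong (_% 2) (*-comm 2 n)) (m*n%n≡0 n 2) = s≤s (s≤s z≤n)

lchild rchild : ℕ → ℕ → Vertex
lchild j n = (j , 2 * n)
rchild j n = (j , suc (2 * n))

parent-lchild : ∀ j n → parent (lchild j n) ≡ (suc j , n)
parent-lchild j n = cong (suc j ,_) (2*n/2≡n n)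

parent-rchild : ∀ j n → parent (rchild j n) ≡ (suc j , n)
parent-rchild j n = cong (suc j ,_) ([1+2*n]/2≡n n)

anc-suc : ∀ k v → anc (suc k) v ≡ parent (anc k v)
anc-suc zero    v = refl
anc-suc (suc k) v = anc-suc k (parent v)

anc-level : ∀ k v → level (anc k v) ≡ level v + k
anc-level zero    v = sym (+-identityʳ (level v))
anc-level (suc k) v = trans (anc-level k (parent v)) (sym (+-suc (level v) k))

infix 4 _≼_

_≼_ : Vertex → Vertex → Set
u ≼ v = level u ≤ level v × anc (level v ∸ level u) u ≡ v

private
  m∸n≡1+m∸[1+n] : ∀ {m n} → n < m → m ∸ n ≡ suc (m ∸ suc n)
  m∸n≡1+m∸[1+n] = +-∸-assoc 1

≼-refl : ∀ v → v ≼ v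
≼-refl v = ≤-refl , cong (λ k → anc k v) (n∸n≡0 (level v))

≼-anc : ∀ k v → v ≼ anc k v
≼-anc k v rewrite anc-level k v = m≤m+n (level v) k , cong (λ i → anc i v) (m+n∸m≡n (level v) k)

≼-parent : ∀ {u v} → u ≼ v → u ≼ parent v
≼-parent {u} {v} (u≤v , anc≡v) =
  m≤n⇒m≤1+n u≤v , trans (cong (λ k → anc k u) (m∸n≡1+m∸[1+n] (s≤s u≤v))) (trans (anc-suc (level v ∸ level u) u) (cong parent anc≡v))

parent-≼⇒≼ : ∀ {u v} → parent u ≼ v → u ≼ v
parent-≼⇒≼ {u} (u<v , anc≡v) = <⇒≤ u<v , trans (cong (λ k → anc k u) (m∸n≡1+m∸[1+n] u<v)) anc≡v

≼⇒≡⊎parent-≼ : ∀ {u v} → u ≼ v → u ≡ v ⊎ parent u ≼ v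
≼⇒≡⊎parent-≼ {u} {v} (u≤v , anc≡v) with m≤n⇒m<n∨m≡n u≤v
... | inj₁ u<v  = inj₂ (u<v , trans (sym (cong (λ k → anc k u) (m∸n≡1+m∸[1+n] u<v))) anc≡v)
... | inj₂ refl = inj₁ (trans (cong (λ k → anc k u) (sym (n∸n≡0 (level u)))) anc≡v)

≼-same-level : ∀ {u j m m′} → u ≼ (j , m) → u ≼ (j , m′) → m ≡ m′
≼-same-level (_ , anc≡v) (_ , anc≡v′) = cong proj₂ (trans (sym anc≡v) anc≡v′)

-- The edge {v , parent v} is the only edge of T_∞ joining T_v to the rest of the tree.
leaving-walk⇒top-edge∈ : ∀ {H u w v} → Walk H u w → u ≼ v → ¬ w ≼ v → v ∈ edges H
leaving-walk⇒top-edge∈ here u≼v w⋠v = ⊥-elim (w⋠v u≼v)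
leaving-walk⇒top-edge∈ (step (inj₁ (u∈H , refl)) walk) u≼v w⋠v with ≼⇒≡⊎parent-≼ u≼v
... | inj₁ refl = u∈H
... | inj₂ pu≼v = leaving-walk⇒top-edge∈ walk pu≼v w⋠v
leaving-walk⇒top-edge∈ (step (inj₂ (_ , refl)) walk) u≼v w⋠v = leaving-walk⇒top-edge∈ walk (parent-≼⇒≼ u≼v) w⋠v

InV⇒∈vertexList : ∀ {H v} → InV H v → v ∈ vertexList H
InV⇒∈vertexList     (_ , inj₁ (v∈H , _))    = ∈-deduplicate⁺ _≟V_ (∈-++⁺ˡ v∈H)
InV⇒∈vertexList {H} (_ , inj₂ (u∈H , refl)) = ∈-deduplicate⁺ _≟V_ (∈-++⁺ʳ (edges H) (∈-map⁺ parent u∈H))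

module ReachableBelow (H : Subgraph) where

  LeafReachable : Vertex → Set
  LeafReachable v = ∃ λ ℓ → LeafOf v ℓ × Walk H v ℓ

  leafReachable-parent : ∀ {c v} → c ∈ edges H → parent c ≡ v → LeafReachable c → LeafReachable v
  leafReachable-parent {c} c∈H refl (ℓ , (ℓ₀ , anc≡c) , walk) =
    ℓ , (ℓ₀ , trans (anc-suc (level c) ℓ) (cong parent anc≡c)) , step (inj₂ (c∈H , refl)) walk

  -- reachEdges j n and reachBoundary j n list the edges (by lower endpoint) and the non-leaf
  -- boundary vertices of the part of H reachable from (j , n) by walks of H inside T_(j,n).
  reachEdges : ℕ → ℕ → List Vertex
  reachEdges zero    n = []
  reachEdges (suc j) n =
    keepIf (lchild j n ∈V? edges H) (lchild j n ∷ reachEdges j (2 * n)) ++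
    keepIf (rchild j n ∈V? edges H) (rchild j n ∷ reachEdges j (suc (2 * n)))

  reachBoundary : ℕ → ℕ → List Vertex
  childBoundary : ℕ → ℕ → List Vertex

  reachBoundary zero    n = []
  reachBoundary (suc j) n = keepIf (missingIncident? H (suc j , n)) ((suc j , n) ∷ []) ++ childBoundary j n

  childBoundary j n =
    keepIf (lchild j n ∈V? edges H) (reachBoundary j (2 * n)) ++
    keepIf (rchild j n ∈V? edges H) (reachBoundary j (suc (2 * n)))

  ∈-reachEdges-parent : ∀ {x} c → c ∈ edges H → x ∈ c ∷ uncurry reachEdges c → x ∈ uncurry reachEdges (parent c)
  ∈-reachEdges-parent (j , m) c∈H x∈ with parity m
  ... | even q = subst (λ k → _ ∈ reachEdges (suc j) k) (sym (2*n/2≡n q))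
                   (∈-++⁺ˡ (∈-keepIf⁺ (lchild j q ∈V? edges H) c∈H x∈))
  ... | odd q  = subst (λ k → _ ∈ reachEdges (suc j) k) (sym ([1+2*n]/2≡n q))
                   (∈-++⁺ʳ _ (∈-keepIf⁺ (rchild j q ∈V? edges H) c∈H x∈))

  ∈-reachEdges-anc : ∀ k e → (∀ i → i < k → anc i e ∈ edges H) → e ∈ anc k e ∷ uncurry reachEdges (anc k e)
  ∈-reachEdges-anc zero    e _     = here refl
  ∈-reachEdges-anc (suc k) e below =
    there (subst (λ v → e ∈ uncurry reachEdges v) (sym (anc-suc k e))
      (∈-reachEdges-parent (anc k e) (below k ≤-refl)
        (∈-reachEdges-anc k e (λ i i<k → below i (m≤n⇒m≤1+n i<k)))))

  ancestors-below∈edges : ∀ {e y} → Connected H → InV H y → e ∈ edges H → InETy y e →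
                      ∀ i → i < level y ∸ level e → anc i e ∈ edges H
  ancestors-below∈edges {e} {y} connected y∈V e∈H (e<y , _) i i<d =
    leaving-walk⇒top-edge∈ (connected e y (parent e , inj₁ (e∈H , refl)) y∈V) (≼-anc i e)
      (λ y≼ → <⇒≱ anc<y (proj₁ y≼))
    where
    open ≤-Reasoning
    anc<y : level (anc i e) < level y
    anc<y = begin-strict
      level (anc i e)              ≡⟨ anc-level i e ⟩
      level e + i                  <⟨ +-monoʳ-< (level e) i<d ⟩
      level e + (level y ∸ level e) ≡⟨ m+[n∸m]≡n (<⇒≤ e<y) ⟩
      level y                      ∎

  edgesInTy⊆reachEdges : ∀ {y} → Connected H → InV H y → filter (properDesc? y) (edges H) ⊆ uncurry reachEdges y
  edgesInTy⊆reachEdges {y} connected y∈V {e} e∈ with ∈-filter⁻ (properDesc? y) e∈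
  ... | e∈H , inTy@(e<y , anc≡y)
    with subst (λ v → e ∈ v ∷ uncurry reachEdges v) anc≡y
           (∈-reachEdges-anc _ e (ancestors-below∈edges connected y∈V e∈H inTy))
  ... | here refl  = ⊥-elim (<-irrefl refl e<y)
  ... | there e∈R = e∈R

  ∈-reachBoundary⁻ : ∀ {x} j n → x ∈ reachBoundary (suc j) n →
    (x ≡ (suc j , n) × MissingIncident H (suc j , n)) ⊎ x ∈ childBoundary j n
  ∈-reachBoundary⁻ j n x∈ with ∈-++⁻ (keepIf (missingIncident? H (suc j , n)) _) x∈
  ... | inj₂ x∈c = inj₂ x∈c
  ... | inj₁ x∈ₘ with ∈-keepIf⁻ (missingIncident? H (suc j , n)) x∈ₘ
  ...   | missing , here refl = inj₁ (refl , missing)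

  ∈-childBoundary⁻ : ∀ {x} j n → x ∈ childBoundary j n →
    (lchild j n ∈ edges H × x ∈ reachBoundary j (2 * n)) ⊎ (rchild j n ∈ edges H × x ∈ reachBoundary j (suc (2 * n)))
  ∈-childBoundary⁻ j n =
    Sum.map (∈-keepIf⁻ (lchild j n ∈V? edges H)) (∈-keepIf⁻ (rchild j n ∈V? edges H)) ∘ ∈-++⁻ (keepIf (lchild j n ∈V? edges H) _)

  reachBoundary-≼ : ∀ {x} j n → x ∈ reachBoundary j n → x ≼ (j , n)
  childBoundary-≼ : ∀ {x} j n → x ∈ childBoundary j n → x ≼ (suc j , n)

  reachBoundary-≼ (suc j) n x∈ with ∈-reachBoundary⁻ j n x∈
  ... | inj₁ (refl , _) = ≼-refl _
  ... | inj₂ x∈c        = childBoundary-≼ j n x∈c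

  childBoundary-≼ {x} j n x∈ with ∈-childBoundary⁻ j n x∈
  ... | inj₁ (_ , x∈ₗ) = subst (x ≼_) (parent-lchild j n) (≼-parent (reachBoundary-≼ j (2 * n) x∈ₗ))
  ... | inj₂ (_ , x∈ᵣ) = subst (x ≼_) (parent-rchild j n) (≼-parent (reachBoundary-≼ j (suc (2 * n)) x∈ᵣ))

  reachBoundary-unique : ∀ j n → Unique (reachBoundary j n)
  childBoundary-unique : ∀ j n → Unique (childBoundary j n)

  reachBoundary-unique zero    n = []
  reachBoundary-unique (suc j) n =
    Unique.++⁺ (keepIf-unique (missingIncident? H (suc j , n)) ([] ∷ [])) (childBoundary-unique j n) self∉children
    where
    self∉children : ∀ {x} → ¬ (x ∈ keepIf (missingIncident? H (suc j , n)) ((suc j , n) ∷ []) × x ∈ childBoundary j n)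
    self∉children (x∈ₘ , x∈c) with ∈-keepIf⁻ (missingIncident? H (suc j , n)) x∈ₘ | ∈-childBoundary⁻ j n x∈c
    ... | _ , here refl | inj₁ (_ , x∈ₗ) = 1+n≰n (proj₁ (reachBoundary-≼ j _ x∈ₗ))
    ... | _ , here refl | inj₂ (_ , x∈ᵣ) = 1+n≰n (proj₁ (reachBoundary-≼ j _ x∈ᵣ))

  childBoundary-unique j n =
    Unique.++⁺ (keepIf-unique (lchild j n ∈V? edges H) (reachBoundary-unique j (2 * n)))
               (keepIf-unique (rchild j n ∈V? edges H) (reachBoundary-unique j (suc (2 * n))))
               left∩right
    where
    left∩right : ∀ {x} → ¬ (x ∈ keepIf (lchild j n ∈V? edges H) (reachBoundary j (2 * n)) ×
                            x ∈ keepIf (rchild j n ∈V? edges H) (reachBoundary j (suc (2 * n))))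
    left∩right (x∈ₗ , x∈ᵣ) = even≢odd n n (≼-same-level
      (reachBoundary-≼ j _ (proj₂ (∈-keepIf⁻ (lchild j n ∈V? edges H) x∈ₗ)))
      (reachBoundary-≼ j _ (proj₂ (∈-keepIf⁻ (rchild j n ∈V? edges H) x∈ᵣ))))

  reachBoundary-missing : ∀ {x} j n → InV H (j , n) → x ∈ reachBoundary j n → MissingIncident H x × InV H x
  childBoundary-missing : ∀ {x} j n → x ∈ childBoundary j n → MissingIncident H x × InV H x

  reachBoundary-missing (suc j) n v∈V x∈ with ∈-reachBoundary⁻ j n x∈
  ... | inj₁ (refl , missing) = missing , v∈V
  ... | inj₂ x∈c              = childBoundary-missing j n x∈c

  childBoundary-missing j n x∈ with ∈-childBoundary⁻ j n x∈
  ... | inj₁ (c∈H , x∈ₗ) = reachBoundary-missing j (2 * n) (_ , inj₁ (c∈H , refl)) x∈ₗ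
  ... | inj₂ (c∈H , x∈ᵣ) = reachBoundary-missing j (suc (2 * n)) (_ , inj₁ (c∈H , refl)) x∈ᵣ

  reachBoundary⊆boundary : ∀ {j n} → InV H (j , n) → reachBoundary j n ⊆ filter (missingIncident? H) (vertexList H)
  reachBoundary⊆boundary {j} {n} v∈V x∈ with reachBoundary-missing j n v∈V x∈
  ... | missing , x∈V = ∈-filter⁺ (missingIncident? H) (InV⇒∈vertexList {H} x∈V) missing

  branch-bound : ∀ {c m} (d : Dec (c ∈ edges H)) {es bs : List Vertex} →
                 (c ∈ edges H → 2 + length es ≤ 2 * length bs) → (c ∉ edges H → m ≡ 1) →
                 1 + length (keepIf d (c ∷ es)) ≤ 2 * length (keepIf d bs) + m
  branch-bound (yes c∈H) bound _   = ≤-trans (bound c∈H) (m≤m+n _ _)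
  branch-bound (no c∉H)  _     m≡1 = ≤-reflexive (sym (m≡1 c∉H))

  reach-count : ∀ j n → ¬ LeafReachable (j , n) → 2 + length (reachEdges j n) ≤ 2 * length (reachBoundary j n)
  reach-count zero    n noLeaf = ⊥-elim (noLeaf ((zero , n) , (refl , refl) , here))
  reach-count (suc j) n noLeaf = begin
    2 + length (Eₗ ++ Eᵣ)                    ≡⟨ cong (2 +_) (length-++ Eₗ {Eᵣ}) ⟩
    2 + (length Eₗ + length Eᵣ)              ≤⟨ branch-bounds-sum {b = length Bₗ} {d = length Bᵣ}
                                                    (branch-bound dₗ boundₗ missingₗ) (branch-bound dᵣ boundᵣ missingᵣ) ⟩
    2 * (length S + (length Bₗ + length Bᵣ)) ≡⟨ cong (2 *_) (sym (trans (length-++ S {Bₗ ++ Bᵣ}) (cong (length S +_) (length-++ Bₗ {Bᵣ})))) ⟩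
    2 * length (S ++ (Bₗ ++ Bᵣ))             ∎
    where
    open ≤-Reasoning
    dₘ = missingIncident? H (suc j , n)
    dₗ = lchild j n ∈V? edges H
    dᵣ = rchild j n ∈V? edges H
    S  = keepIf dₘ ((suc j , n) ∷ [])
    Eₗ = keepIf dₗ (lchild j n ∷ reachEdges j (2 * n))
    Eᵣ = keepIf dᵣ (rchild j n ∷ reachEdges j (suc (2 * n)))
    Bₗ = keepIf dₗ (reachBoundary j (2 * n))
    Bᵣ = keepIf dᵣ (reachBoundary j (suc (2 * n)))
    boundₗ : lchild j n ∈ edges H → 2 + length (reachEdges j (2 * n)) ≤ 2 * length (reachBoundary j (2 * n))
    boundₗ c∈H = reach-count j (2 * n) (noLeaf ∘ leafReachable-parent c∈H (parent-lchild j n))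
    boundᵣ : rchild j n ∈ edges H → 2 + length (reachEdges j (suc (2 * n))) ≤ 2 * length (reachBoundary j (suc (2 * n)))
    boundᵣ c∈H = reach-count j (suc (2 * n)) (noLeaf ∘ leafReachable-parent c∈H (parent-rchild j n))
    missingₗ : lchild j n ∉ edges H → length S ≡ 1
    missingₗ c∉H = cong length (keepIf-yes dₘ (inj₂ (inj₁ c∉H)))
    missingᵣ : rchild j n ∉ edges H → length S ≡ 1
    missingᵣ c∉H = cong length (keepIf-yes dₘ (inj₂ (inj₂ c∉H)))

corollary3p11 : (H : Subgraph) (y : Vertex) →
    Connected H → InV H y →
    (∃ λ e → e ∈ edges H × InETy y e) →
    ¬ (∃ λ ℓ → LeafOf y ℓ × Walk H y ℓ) →
    suc (edgesInTy H y) ≤ 2 * boundary H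
corollary3p11 H (j , n) connected y∈V _ noLeaf = begin
  suc (edgesInTy H (j , n))       ≤⟨ s≤s (unique-⊆⇒length-≤ _≟V_ (Unique.filter⁺ (properDesc? (j , n)) (unique H))
                                                                 (edgesInTy⊆reachEdges connected y∈V)) ⟩
  suc (length (reachEdges j n))   ≤⟨ n≤1+n _ ⟩
  2 + length (reachEdges j n)     ≤⟨ reach-count j n noLeaf ⟩
  2 * length (reachBoundary j n)  ≤⟨ *-monoʳ-≤ 2 (unique-⊆⇒length-≤ _≟V_ (reachBoundary-unique j n)
                                                                       (reachBoundary⊆boundary y∈V)) ⟩
  2 * boundary H                  ∎
  where
  open ≤-Reasoning
  open ReachableBelow H
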